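{- For every integer $k\ge 2$ and every $n\in\mathbb{N}$, $\mu(n,2^k-1)=\mu(n,2^k-2)$.
   Context: $\mathbb{F}_2$ is the field with two elements. For $u\in\mathbb{F}_2^n$, $|u|$ is the number of entries of $u$ equal to $1$. For an $n\times n$ matrix $W$ over $\mathbb{F}_2$, $M(W,0)=\max\{|Wx| : x\in\mathbb{F}_2^n\}$. For $n,m\ge 1$, $A(n,m)$ is the set of $n\times n$ matrices over $\mathbb{F}_2$ with all diagonal entries $1$ and every column containing at most $m$ ones, and $\mu(n,m)=\min\{M(W,0):W\in A(n,m)\}$. -}

module Defs where

open import Data.Bool using (Bool; true; false; _∧_; _xor_; if_then_else_)
open import Data.Nat using (ℕ; zero; suc; _≤ᵇ_; _⊔_; _⊓_)
open import Data.Fin using (Fin)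
open import Data.List using (List; []; _∷_; concatMap; map; foldr; filter)
open import Data.Vec using (Vec; []; _∷_; lookup; tabulate; allFin)
open import Data.Maybe using (Maybe; just; nothing)

-- F₂ is modelled by Bool: addition = _xor_, multiplication = _∧_.
F₂ : Set
F₂ = Bool

allVecsOf : {A : Set} → List A → (n : ℕ) → List (Vec A n)
allVecsOf xs zero    = [] ∷ []
allVecsOf xs (suc n) = concatMap (λ x → map (x ∷_) (allVecsOf xs n)) xs

allVecs : (n : ℕ) → List (Vec F₂ n)
allVecs n = allVecsOf (false ∷ true ∷ []) n

-- n×n matrices over F₂, stored as a vector of rows: lookup (lookup W i) j = W_{ij}
Mat : ℕ → Set
Mat n = Vec (Vec F₂ n) n

allMats : (n : ℕ) → List (Mat n)
allMats n = allVecsOf (allVecs n) n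

entry : {n : ℕ} → Mat n → Fin n → Fin n → F₂
entry W i j = lookup (lookup W i) j

countOnes : {n : ℕ} → Vec Bool n → ℕ
countOnes []           = 0
countOnes (true  ∷ v)  = suc (countOnes v)
countOnes (false ∷ v)  = countOnes v

weight : {n : ℕ} → Vec F₂ n → ℕ
weight = countOnes

sumF₂ : {n : ℕ} → Vec F₂ n → F₂
sumF₂ []      = false
sumF₂ (x ∷ v) = x xor sumF₂ v

_·_ : {n : ℕ} → Mat n → Vec F₂ n → Vec F₂ n
W · x = tabulate (λ i → sumF₂ (tabulate (λ j → entry W i j ∧ lookup x j)))

maxList : List ℕ → ℕ
maxList = foldr _⊔_ 0

-- M(W,0) = max { |Wx| : x ∈ F₂ⁿ }
M : {n : ℕ} → Mat n → ℕ
M {n} W = maxList (map (λ x → weight (W · x)) (allVecs n))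

allB : {n : ℕ} → Vec Bool n → Bool
allB []      = true
allB (b ∷ v) = b ∧ allB v

diagOnes : {n : ℕ} → Mat n → Bool
diagOnes {n} W = allB (tabulate (λ i → entry W i i))

colsAtMost : {n : ℕ} → ℕ → Mat n → Bool
colsAtMost {n} m W = allB (tabulate (λ j → countOnes (tabulate (λ i → entry W i j)) ≤ᵇ m))

inA : (n m : ℕ) → Mat n → Bool
inA n m W = diagOnes W ∧ colsAtMost m W

A : (n m : ℕ) → List (Mat n)
A n m = filter (λ W → Data.Bool._≟_ (inA n m W) true) (allMats n)
  where import Data.Bool

minList : List ℕ → Maybe ℕ
minList []       = nothing
minList (x ∷ xs) with minList xs
... | nothing = just x
... | just y  = just (x ⊓ y)

-- μ(n,m) = min { M(W,0) : W ∈ A(n,m) }  (nothing iff A(n,m) is empty)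
μ : ℕ → ℕ → Maybe ℕ
μ n m = minList (map M (A n m))

-- Trivially μ(n, 2^k − 1) ≤ μ(n, 2^k − 2), since A(n, 2^k − 2) ⊆ A(n, 2^k − 1).  Conversely let W have
-- a column j₀ of full weight 2^k − 1, with support S.  Replace the S × S block of W by a matrix whose
-- columns are codewords of the simplex code of length 2^k − 1 (one with a 1 at each diagonal position),
-- and clear the blocks between S and its complement.  The new columns on S have weight at most 2^(k−1),
-- which is ≤ 2^k − 2 for k ≥ 2, and no other column gets heavier.  For every x, the new matrix maps x to
-- a simplex codeword (weight ≤ 2^(k−1)) on S and to W y off S, where y is x cleared on S.  Since column j₀
-- is the all-ones vector on S, W y and W (y + e_{j₀}) agree off S and are complementary on S, so one of
-- them has at least 2^(k−1) ones on S: the maximal weight does not increase.  Repeating this removes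
-- every heavy column.

module Submission where

open import Defs
open import Data.Nat using (ℕ; _≤_; _^_; _∸_)
open import Relation.Binary.PropositionalEquality using (_≡_)

open import Algebra.Bundles using (CommutativeRing; CommutativeMonoid)
import Algebra.Properties.CommutativeMonoid.Sum as CommutativeMonoidSum
import Algebra.Properties.CommutativeSemigroup as CommutativeSemigroupProperties
import Algebra.Properties.Semiring.Sum as SemiringSum
open import Data.Bool using (Bool; true; false; not; _∧_; _xor_; if_then_else_; T)
import Data.Bool as Bool
open import Data.Bool.Properties
  using (∧-comm; ∧-identityʳ; ∧-zeroʳ; ∧-distribˡ-xor; xor-identityʳ; xor-∧-commutativeRing; T-∧; T-≡)
open import Data.Empty using (⊥-elim)
open import Data.Fin using (Fin; zero; suc; toℕ)
open import Data.Fin.Properties using (any?; toℕ<n)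
open import Data.List using (List; []; _∷_; map)
open import Data.List.Membership.Propositional using (_∈_)
open import Data.List.Membership.Propositional.Properties
  using (∈-map⁺; ∈-map⁻; ∈-filter⁺; ∈-filter⁻; ∈-concatMap⁺)
open import Data.List.Relation.Unary.Any using (here; there)
import Data.List.Relation.Unary.Any as Any
open import Data.Maybe using (just; nothing)
open import Data.Nat using (zero; suc; _+_; _*_; _<_; _<ᵇ_; _⊓_; z≤n; s≤s)
open import Data.Nat.Induction using (<-wellFounded)
open import Data.Nat.Properties
open import Data.Product using (Σ-syntax; ∃-syntax; _×_; _,_; proj₁; proj₂)
open import Data.Sum using (_⊎_; inj₁; inj₂)
open import Data.Unit using (tt)
open import Data.Vec using (Vec; []; _∷_; lookup; tabulate; replicate; zipWith)
open import Data.Vec.Properties using (lookup∘tabulate)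
open import Function using (_∘_; id; Equivalence)
open import Induction.WellFounded using (Acc; acc)
open import Relation.Binary.PropositionalEquality using (refl; sym; trans; cong; cong₂; subst; _≗_; module ≡-Reasoning)
open import Relation.Nullary using (¬_; yes; no)
open import Relation.Nullary.Decidable using (T?)

module ⊕ = SemiringSum (CommutativeRing.semiring xor-∧-commutativeRing)
module Σ = CommutativeMonoidSum +-0-commutativeMonoid

open CommutativeSemigroupProperties
  (CommutativeMonoid.commutativeSemigroup (CommutativeRing.+-commutativeMonoid xor-∧-commutativeRing))
  using () renaming (interchange to xor-interchange)

indicator : Bool → ℕ
indicator false = 0
indicator true  = 1

indicator-mono : ∀ {a b} → (T a → T b) → indicator a ≤ indicator b
indicator-mono {false}         _   = z≤n
indicator-mono {true}  {true}  _   = ≤-refl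
indicator-mono {true}  {false} a⇒b = ⊥-elim (a⇒b tt)

indicator-< : ∀ {a b} → ¬ T a → T b → indicator a < indicator b
indicator-< {true}          ¬a _ = ⊥-elim (¬a tt)
indicator-< {false} {true}  ¬a _ = s≤s z≤n

indicator-partition : ∀ s b → indicator b ≡ indicator (s ∧ b) + indicator (not s ∧ b)
indicator-partition true  b = sym (+-identityʳ _)
indicator-partition false b = refl

indicator-complement : ∀ s b → indicator (s ∧ b) + indicator (s ∧ not b) ≡ indicator s
indicator-complement true  true  = refl
indicator-complement true  false = refl
indicator-complement false b     = refl

count : ∀ {n} → (Fin n → Bool) → ℕ
count f = Σ.sum (λ i → indicator (f i))

count-cong : ∀ {n} {f g : Fin n → Bool} → f ≗ g → count f ≡ count g
count-cong f≗g = Σ.sum-cong-≗ (cong indicator ∘ f≗g)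

count-true : ∀ n → count {n} (λ _ → true) ≡ n
count-true zero    = refl
count-true (suc n) = cong suc (count-true n)

count-mono : ∀ {n} {f g : Fin n → Bool} → (∀ i → T (f i) → T (g i)) → count f ≤ count g
count-mono {zero}  f⇒g = z≤n
count-mono {suc n} f⇒g = +-mono-≤ (indicator-mono (f⇒g zero)) (count-mono (f⇒g ∘ suc))

count-mono-< : ∀ {n} {f g : Fin n → Bool} (j : Fin n) →
               (∀ i → T (f i) → T (g i)) → ¬ T (f j) → T (g j) → count f < count g
count-mono-< zero    f⇒g ¬fj gj = +-mono-<-≤ (indicator-< ¬fj gj) (count-mono (f⇒g ∘ suc))
count-mono-< (suc j) f⇒g ¬fj gj = +-mono-≤-< (indicator-mono (f⇒g zero)) (count-mono-< j (f⇒g ∘ suc) ¬fj gj)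

count-partition : ∀ {n} (S f : Fin n → Bool) →
                  count f ≡ count (λ i → S i ∧ f i) + count (λ i → not (S i) ∧ f i)
count-partition S f = trans (Σ.sum-cong-≗ (λ i → indicator-partition (S i) (f i)))
                            (Σ.∑-distrib-+ (λ i → indicator (S i ∧ f i)) (λ i → indicator (not (S i) ∧ f i)))

count-complement : ∀ {n} (S f : Fin n → Bool) →
                   count (λ i → S i ∧ f i) + count (λ i → S i ∧ not (f i)) ≡ count S
count-complement S f = trans (sym (Σ.∑-distrib-+ (λ i → indicator (S i ∧ f i)) (λ i → indicator (S i ∧ not (f i)))))
                             (Σ.sum-cong-≗ (λ i → indicator-complement (S i) (f i)))

countBelow : ℕ → (ℕ → Bool) → ℕ
countBelow L f = count {L} (λ r → f (toℕ r))

countBelow-cong : ∀ L {f g : ℕ → Bool} → (∀ r → r < L → f r ≡ g r) → countBelow L f ≡ countBelow L g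
countBelow-cong L f≡g = count-cong (λ r → f≡g (toℕ r) (toℕ<n r))

countBelow-+ : ∀ a b (f : ℕ → Bool) → countBelow (a + b) f ≡ countBelow a f + countBelow b (λ r → f (a + r))
countBelow-+ zero    b f = refl
countBelow-+ (suc a) b f =
  trans (cong (indicator (f 0) +_) (countBelow-+ a b (f ∘ suc))) (sym (+-assoc (indicator (f 0)) _ _))

-- The simplex code

simplexLength : ℕ → ℕ
simplexLength zero    = 0
simplexLength (suc k) = suc (simplexLength k + simplexLength k)

suc-simplexLength : ∀ k → suc (simplexLength k) ≡ 2 ^ k
suc-simplexLength zero    = refl
suc-simplexLength (suc k) = begin
  suc (suc (N + N))  ≡⟨ cong suc (sym (+-suc N N)) ⟩
  suc N + suc N      ≡⟨ cong (λ p → p + p) (suc-simplexLength k) ⟩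
  2 ^ k + 2 ^ k      ≡⟨ cong (2 ^ k +_) (sym (+-identityʳ (2 ^ k))) ⟩
  2 ^ suc k          ∎
  where open ≡-Reasoning
        N : ℕ
        N = simplexLength k

-- The codeword of s ∷ a is s, then the codeword c of a, then s ⊕ c: the usual doubling construction of the
-- simplex code, whose nonzero words all have weight 2^(k−1).
codeword : ∀ {k} → Vec Bool k → ℕ → Bool
codeword []              ρ       = false
codeword (s ∷ a)         zero    = s
codeword {suc k} (s ∷ a) (suc ρ) =
  if ρ <ᵇ simplexLength k then codeword a ρ else s xor codeword a (ρ ∸ simplexLength k)

codeword-low : ∀ {k} s (a : Vec Bool k) {ρ} → ρ < simplexLength k → codeword (s ∷ a) (suc ρ) ≡ codeword a ρ
codeword-low {k} s a {ρ} ρ<N with ρ <ᵇ simplexLength k | <⇒<ᵇ ρ<N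
... | true | _ = refl

codeword-high : ∀ {k} s (a : Vec Bool k) ρ → codeword (s ∷ a) (suc (simplexLength k + ρ)) ≡ s xor codeword a ρ
codeword-high {k} s a ρ with simplexLength k + ρ <ᵇ simplexLength k in eq
... | true  = ⊥-elim (m+n≮m _ ρ (<ᵇ⇒< (simplexLength k + ρ) (simplexLength k) (subst T (sym eq) tt)))
... | false = cong (λ r → s xor codeword a r) (m+n∸m≡n (simplexLength k) ρ)

codeword-replicate : ∀ k ρ → codeword (replicate k false) ρ ≡ false
codeword-replicate zero    ρ       = refl
codeword-replicate (suc k) zero    = refl
codeword-replicate (suc k) (suc ρ) with ρ <ᵇ simplexLength k
... | true  = codeword-replicate k ρ
... | false = codeword-replicate k (ρ ∸ simplexLength k)

codeword-xor : ∀ {k} (a b : Vec Bool k) ρ → codeword (zipWith _xor_ a b) ρ ≡ codeword a ρ xor codeword b ρ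
codeword-xor []      []      ρ       = refl
codeword-xor (s ∷ a) (t ∷ b) zero    = refl
codeword-xor {suc k} (s ∷ a) (t ∷ b) (suc ρ) with ρ <ᵇ simplexLength k
... | true  = codeword-xor a b ρ
... | false = trans (cong ((s xor t) xor_) (codeword-xor a b _)) (xor-interchange s t _ _)

combination : ∀ {n k} → (Fin n → Bool) → (Fin n → Vec Bool k) → Vec Bool k
combination {zero}  {k} b v = replicate k false
combination {suc n} {k} b v = if b zero then zipWith _xor_ (v zero) rest else rest
  where rest : Vec Bool k
        rest = combination (b ∘ suc) (v ∘ suc)

codeword-combination : ∀ {n k} (b : Fin n → Bool) (v : Fin n → Vec Bool k) ρ →
                       codeword (combination b v) ρ ≡ ⊕.sum (λ j → b j ∧ codeword (v j) ρ)
codeword-combination {zero} {k} b v ρ = codeword-replicate k ρ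
codeword-combination {suc n} b v ρ with b zero
... | true  = trans (codeword-xor (v zero) _ ρ)
                    (cong (codeword (v zero) ρ xor_) (codeword-combination (b ∘ suc) (v ∘ suc) ρ))
... | false = codeword-combination (b ∘ suc) (v ∘ suc) ρ

selector : (k : ℕ) → ℕ → Vec Bool k
selector zero    ρ       = []
selector (suc k) zero    = true ∷ replicate k false
selector (suc k) (suc ρ) =
  false ∷ selector k (if ρ <ᵇ simplexLength k then ρ else ρ ∸ simplexLength k)

codeword-selector : ∀ k ρ → ρ < simplexLength k → T (codeword (selector k ρ) ρ)
codeword-selector (suc k) zero    _         = tt
codeword-selector (suc k) (suc ρ) (s≤s ρ<2N) with ρ <ᵇ simplexLength k in eq
... | true  = codeword-selector k ρ (<ᵇ⇒< _ _ (subst T (sym eq) tt))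
... | false = codeword-selector k (ρ ∸ N) ρ∸N<N
  where
    N : ℕ
    N = simplexLength k
    ρ∸N<N : ρ ∸ N < N
    ρ∸N<N = subst (ρ ∸ N <_) (m+n∸n≡m N N)
                  (∸-monoˡ-< {ρ} {N} {N + N} ρ<2N (≮⇒≥ (λ ρ<N → subst T eq (<⇒<ᵇ {ρ} {N} ρ<N))))

codewordWeight : ∀ {k} → Vec Bool k → ℕ
codewordWeight {k} a = countBelow (simplexLength k) (codeword a)

codewordWeight-∷ : ∀ {k} s (a : Vec Bool k) →
  codewordWeight (s ∷ a) ≡ indicator s + (codewordWeight a + countBelow (simplexLength k) (λ r → s xor codeword a r))
codewordWeight-∷ {k} s a = cong (indicator s +_) (begin
    countBelow (N + N) (λ r → codeword (s ∷ a) (suc r))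
  ≡⟨ countBelow-+ N N (λ r → codeword (s ∷ a) (suc r)) ⟩
    countBelow N (λ r → codeword (s ∷ a) (suc r)) + countBelow N (λ r → codeword (s ∷ a) (suc (N + r)))
  ≡⟨ cong₂ _+_ (countBelow-cong N (λ r → codeword-low s a)) (countBelow-cong N (λ r _ → codeword-high s a r)) ⟩
    codewordWeight a + countBelow N (λ r → s xor codeword a r)
  ∎)
  where open ≡-Reasoning
        N : ℕ
        N = simplexLength k

codewordWeight-bound : ∀ {k} (a : Vec Bool k) → 2 * codewordWeight a ≤ 2 ^ k
codewordWeight-bound []                = z≤n
codewordWeight-bound {suc k} (false ∷ a) = begin
  2 * codewordWeight (false ∷ a)  ≡⟨ cong (2 *_) (codewordWeight-∷ false a) ⟩
  2 * (c + c)                     ≡⟨ cong (λ p → 2 * (c + p)) (sym (+-identityʳ c)) ⟩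
  2 * (2 * c)                     ≤⟨ *-monoʳ-≤ 2 (codewordWeight-bound a) ⟩
  2 ^ suc k                       ∎
  where open ≤-Reasoning
        c : ℕ
        c = codewordWeight a
codewordWeight-bound {suc k} (true ∷ a) = ≤-reflexive (begin
  2 * codewordWeight (true ∷ a)
    ≡⟨ cong (2 *_) (codewordWeight-∷ true a) ⟩
  2 * suc (codewordWeight a + countBelow N (λ r → not (codeword a r)))
    ≡⟨ cong (λ p → 2 * suc p) (trans (count-complement {N} (λ _ → true) (codeword a ∘ toℕ)) (count-true N)) ⟩
  2 * suc N
    ≡⟨ cong (2 *_) (suc-simplexLength k) ⟩
  2 ^ suc k
    ∎)
  where open ≡-Reasoning
        N : ℕ
        N = simplexLength k

rank : ∀ {n} → (Fin n → Bool) → Fin n → ℕ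
rank S zero    = 0
rank S (suc i) = indicator (S zero) + rank (S ∘ suc) i

rank<count : ∀ {n} (S : Fin n → Bool) i → T (S i) → rank S i < count S
rank<count S zero    Si = <-≤-trans (indicator-< (λ ()) Si) (m≤m+n _ _)
rank<count S (suc i) Si = +-monoʳ-< (indicator (S zero)) (rank<count (S ∘ suc) i Si)

count-∧-rank : ∀ {n} (S : Fin n → Bool) (f : ℕ → Bool) →
               count (λ i → S i ∧ f (rank S i)) ≡ countBelow (count S) f
count-∧-rank {zero}  S f = refl
count-∧-rank {suc n} S f with S zero
... | true  = cong (indicator (f 0) +_) (count-∧-rank (S ∘ suc) (f ∘ suc))
... | false = count-∧-rank (S ∘ suc) f

Matrix : ℕ → Set
Matrix n = Fin n → Fin n → Bool

apply : ∀ {n} → Matrix n → (Fin n → Bool) → Fin n → Bool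
apply E x i = ⊕.sum (λ j → E i j ∧ x j)

columnWeight : ∀ {n} → Matrix n → Fin n → ℕ
columnWeight E j = count (λ i → E i j)

WeightBounded : ∀ {n} → ℕ → Matrix n → Set
WeightBounded K E = ∀ x → count (apply E x) ≤ K

record Admissible {n} (m : ℕ) (E : Matrix n) : Set where
  field
    diagonal : ∀ i → T (E i i)
    columns  : ∀ j → columnWeight E j ≤ m

apply-cong : ∀ {n} {E F : Matrix n} {x y : Fin n → Bool} →
             (∀ i j → E i j ≡ F i j) → x ≗ y → apply E x ≗ apply F y
apply-cong E≡F x≗y i = ⊕.sum-cong-≗ (λ j → cong₂ _∧_ (E≡F i j) (x≗y j))

admissible-resp : ∀ {n m} {E F : Matrix n} → (∀ i j → E i j ≡ F i j) → Admissible m E → Admissible m F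
admissible-resp {m = m} E≡F adm = record
  { diagonal = λ i → subst T (E≡F i i) (diagonal i)
  ; columns  = λ j → subst (_≤ m) (count-cong (λ i → E≡F i j)) (columns j)
  }
  where open Admissible adm

weightBounded-resp : ∀ {n K} {E F : Matrix n} → (∀ i j → E i j ≡ F i j) → WeightBounded K E → WeightBounded K F
weightBounded-resp {K = K} E≡F bounded x =
  subst (_≤ K) (count-cong (apply-cong E≡F (λ _ → refl))) (bounded x)

unit : ∀ {n} → Fin n → Fin n → Bool
unit zero     zero    = true
unit zero     (suc j) = false
unit (suc j₀) zero    = false
unit (suc j₀) (suc j) = unit j₀ j

∑-unit : ∀ {n} (f : Fin n → Bool) (j₀ : Fin n) → ⊕.sum (λ j → f j ∧ unit j₀ j) ≡ f j₀
∑-unit {suc n} f zero = begin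
  (f zero ∧ true) xor ⊕.sum (λ j → f (suc j) ∧ false) ≡⟨ cong₂ _xor_ (∧-identityʳ (f zero)) all-zero ⟩
  f zero xor false                                    ≡⟨ xor-identityʳ (f zero) ⟩
  f zero                                              ∎
  where open ≡-Reasoning
        all-zero : ⊕.sum (λ j → f (suc j) ∧ false) ≡ false
        all-zero = trans (⊕.sum-cong-≗ (∧-zeroʳ ∘ f ∘ suc)) (⊕.sum-replicate-zero n)
∑-unit {suc n} f (suc j₀) = cong₂ _xor_ (∧-zeroʳ (f zero)) (∑-unit (f ∘ suc) j₀)

apply-xor-unit : ∀ {n} (E : Matrix n) (y : Fin n → Bool) j₀ i →
                 apply E (λ j → y j xor unit j₀ j) i ≡ apply E y i xor E i j₀
apply-xor-unit E y j₀ i = begin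
  ⊕.sum (λ j → E i j ∧ (y j xor unit j₀ j))
    ≡⟨ ⊕.sum-cong-≗ (λ j → ∧-distribˡ-xor (E i j) _ _) ⟩
  ⊕.sum (λ j → (E i j ∧ y j) xor (E i j ∧ unit j₀ j))
    ≡⟨ ⊕.∑-distrib-+ (λ j → E i j ∧ y j) (λ j → E i j ∧ unit j₀ j) ⟩
  apply E y i xor ⊕.sum (λ j → E i j ∧ unit j₀ j)
    ≡⟨ cong (apply E y i xor_) (∑-unit (E i) j₀) ⟩
  apply E y i xor E i j₀
    ∎
  where open ≡-Reasoning

∧-cong-T : ∀ s {u v} → (T s → u ≡ v) → s ∧ u ≡ s ∧ v
∧-cong-T true  u≡v = u≡v tt
∧-cong-T false u≡v = refl

not∧-cong-T : ∀ s {u v} → (¬ T s → u ≡ v) → not s ∧ u ≡ not s ∧ v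
not∧-cong-T true  u≡v = refl
not∧-cong-T false u≡v = u≡v (λ ())

xor-T : ∀ a {b} → T b → a xor b ≡ not a
xor-T true  {true} _ = refl
xor-T false {true} _ = refl

xor-¬T : ∀ a {b} → ¬ T b → a xor b ≡ a
xor-¬T a {true}  ¬b = ⊥-elim (¬b tt)
xor-¬T a {false} ¬b = xor-identityʳ a

splice : ∀ {n} → (Fin n → Bool) → Matrix n → Matrix n → Matrix n
splice S B E i j = if S i then S j ∧ B i j else not (S j) ∧ E i j

module _ {n} (S : Fin n → Bool) (B E : Matrix n) where

  splice-diagonal : (∀ i → T (S i) → T (B i i)) → (∀ i → T (E i i)) → ∀ i → T (splice S B E i i)
  splice-diagonal B-diag E-diag i with S i | B-diag i
  ... | true  | Bii = Bii tt
  ... | false | _   = E-diag i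

  columnWeight-splice-inside : ∀ j → T (S j) → columnWeight (splice S B E) j ≡ count (λ i → S i ∧ B i j)
  columnWeight-splice-inside j Sj = count-cong (λ i → inside i Sj)
    where
      inside : ∀ i → T (S j) → splice S B E i j ≡ (S i ∧ B i j)
      inside i t with S i | S j
      ... | _     | false = ⊥-elim t
      ... | true  | true  = refl
      ... | false | true  = refl

  columnWeight-splice-outside : ∀ j → ¬ T (S j) → columnWeight (splice S B E) j ≤ columnWeight E j
  columnWeight-splice-outside j ¬Sj = count-mono (λ i → outside i ¬Sj)
    where
      outside : ∀ i → ¬ T (S j) → T (splice S B E i j) → T (E i j)
      outside i ¬t with S i | S j
      ... | _     | true  = ⊥-elim (¬t tt)
      ... | true  | false = λ ()
      ... | false | false = id

  apply-splice-inside : ∀ x i → T (S i) → apply (splice S B E) x i ≡ apply B (λ j → S j ∧ x j) i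
  apply-splice-inside x i Si = ⊕.sum-cong-≗ (inside Si)
    where
      inside : T (S i) → ∀ j → (splice S B E i j ∧ x j) ≡ (B i j ∧ (S j ∧ x j))
      inside t j with S i | S j
      ... | false | _     = ⊥-elim t
      ... | true  | true  = refl
      ... | true  | false = sym (∧-zeroʳ (B i j))

  apply-splice-outside : ∀ x i → ¬ T (S i) → apply (splice S B E) x i ≡ apply E (λ j → not (S j) ∧ x j) i
  apply-splice-outside x i ¬Si = ⊕.sum-cong-≗ (outside ¬Si)
    where
      outside : ¬ T (S i) → ∀ j → (splice S B E i j ∧ x j) ≡ (E i j ∧ (not (S j) ∧ x j))
      outside ¬t j with S i | S j
      ... | true  | _     = ⊥-elim (¬t tt)
      ... | false | true  = sym (∧-zeroʳ (E i j))
      ... | false | false = refl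

-- Removing one column of weight 2^k − 1

at-least-half : ∀ c a b → 2 * c ≤ suc (a + b) → c ≤ a ⊎ c ≤ b
at-least-half c a b 2c≤ with c ≤? a | c ≤? b
... | yes c≤a | _       = inj₁ c≤a
... | no _    | yes c≤b = inj₂ c≤b
... | no c≰a  | no c≰b  = ⊥-elim (<-irrefl refl (begin-strict
  suc (a + b)        <⟨ n<1+n _ ⟩
  suc (suc (a + b))  ≡⟨ sym (+-suc (suc a) b) ⟩
  suc a + suc b      ≤⟨ +-mono-≤ (≰⇒> c≰a) (≰⇒> c≰b) ⟩
  c + c              ≡⟨ cong (c +_) (sym (+-identityʳ c)) ⟩
  2 * c              ≤⟨ 2c≤ ⟩
  suc (a + b)        ∎))
  where open ≤-Reasoning

module Exchange {n k} (E : Matrix n) (j₀ : Fin n) (full : columnWeight E j₀ ≡ simplexLength k) where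

  S : Fin n → Bool
  S i = E i j₀

  -- Enumerating S by rank, column j of the block is a simplex codeword with a 1 in row j.
  block : Matrix n
  block i j = codeword (selector k (rank S j)) (rank S i)

  E′ : Matrix n
  E′ = splice S block E

  E′-diagonal : (∀ i → T (E i i)) → ∀ i → T (E′ i i)
  E′-diagonal = splice-diagonal S block E
    (λ i Si → codeword-selector k (rank S i) (subst (rank S i <_) full (rank<count S i Si)))

  columnWeight-inside : ∀ j → T (S j) → 2 * columnWeight E′ j ≤ 2 ^ k
  columnWeight-inside j Sj = subst (λ w → 2 * w ≤ 2 ^ k) (sym weight≡) (codewordWeight-bound (selector k (rank S j)))
    where
      f : ℕ → Bool
      f = codeword (selector k (rank S j))
      weight≡ : columnWeight E′ j ≡ codewordWeight (selector k (rank S j))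
      weight≡ = trans (columnWeight-splice-inside S block E j Sj)
                 (trans (count-∧-rank S f) (cong (λ L → countBelow L f) full))

  columnWeight-outside : ∀ j → ¬ T (S j) → columnWeight E′ j ≤ columnWeight E j
  columnWeight-outside = columnWeight-splice-outside S block E

  module _ (x : Fin n → Bool) where

    outside : Fin n → Bool
    outside j = not (S j) ∧ x j

    shifted : Fin n → Bool
    shifted j = outside j xor unit j₀ j

    message : Vec Bool k
    message = combination (λ j → S j ∧ x j) (λ j → selector k (rank S j))

    onS onS-flipped offS : ℕ
    onS         = count (λ i → S i ∧ apply E outside i)
    onS-flipped = count (λ i → S i ∧ not (apply E outside i))
    offS        = count (λ i → not (S i) ∧ apply E outside i)

    count-E′ : count (apply E′ x) ≡ codewordWeight message + offS
    count-E′ = trans (count-partition S (apply E′ x)) (cong₂ _+_ on-S off-S)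
      where
        open ≡-Reasoning
        on-S : count (λ i → S i ∧ apply E′ x i) ≡ codewordWeight message
        on-S = begin
          count (λ i → S i ∧ apply E′ x i)
            ≡⟨ count-cong (λ i → ∧-cong-T (S i) (λ Si → begin
                 apply E′ x i
                   ≡⟨ apply-splice-inside S block E x i Si ⟩
                 ⊕.sum (λ j → block i j ∧ (S j ∧ x j))
                   ≡⟨ ⊕.sum-cong-≗ (λ j → ∧-comm (block i j) (S j ∧ x j)) ⟩
                 ⊕.sum (λ j → (S j ∧ x j) ∧ block i j)
                   ≡⟨ codeword-combination (λ j → S j ∧ x j) (λ j → selector k (rank S j)) (rank S i) ⟨
                 codeword message (rank S i) ∎)) ⟩
          count (λ i → S i ∧ codeword message (rank S i))
            ≡⟨ count-∧-rank S (codeword message) ⟩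
          countBelow (count S) (codeword message)
            ≡⟨ cong (λ L → countBelow L (codeword message)) full ⟩
          codewordWeight message ∎
        off-S : count (λ i → not (S i) ∧ apply E′ x i) ≡ offS
        off-S = count-cong (λ i → not∧-cong-T (S i) (apply-splice-outside S block E x i))

    count-outside : count (apply E outside) ≡ onS + offS
    count-outside = count-partition S (apply E outside)

    -- Column j₀ of E is the indicator of S, so adding e_{j₀} to the input complements the image on S
    -- and leaves it unchanged off S.
    count-shifted : count (apply E shifted) ≡ onS-flipped + offS
    count-shifted = trans (count-partition S (apply E shifted)) (cong₂ _+_
      (count-cong (λ i → ∧-cong-T (S i) (λ Si → trans (apply-xor-unit E outside j₀ i) (xor-T _ Si))))
      (count-cong (λ i → not∧-cong-T (S i) (λ ¬Si → trans (apply-xor-unit E outside j₀ i) (xor-¬T _ ¬Si)))))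

    2*codewordWeight≤ : 2 * codewordWeight message ≤ suc (onS + onS-flipped)
    2*codewordWeight≤ = subst (2 * codewordWeight message ≤_)
      (sym (trans (cong suc (trans (count-complement S (apply E outside)) full)) (suc-simplexLength k)))
      (codewordWeight-bound message)

  E′-weightBounded : ∀ {K} → WeightBounded K E → WeightBounded K E′
  E′-weightBounded {K} bounded x
    with at-least-half (codewordWeight (message x)) (onS x) (onS-flipped x) (2*codewordWeight≤ x)
  ... | inj₁ ≤onS = begin
    count (apply E′ x)                   ≡⟨ count-E′ x ⟩
    codewordWeight (message x) + offS x  ≤⟨ +-monoˡ-≤ (offS x) ≤onS ⟩
    onS x + offS x                       ≡⟨ count-outside x ⟨
    count (apply E (outside x))          ≤⟨ bounded (outside x) ⟩
    K                                    ∎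
    where open ≤-Reasoning
  ... | inj₂ ≤onS-flipped = begin
    count (apply E′ x)                   ≡⟨ count-E′ x ⟩
    codewordWeight (message x) + offS x  ≤⟨ +-monoˡ-≤ (offS x) ≤onS-flipped ⟩
    onS-flipped x + offS x               ≡⟨ count-shifted x ⟨
    count (apply E (shifted x))          ≤⟨ bounded (shifted x) ⟩
    K                                    ∎
    where open ≤-Reasoning

heavy : ∀ {n} → ℕ → Matrix n → Fin n → Bool
heavy m E j = m <ᵇ columnWeight E j

2*≤2^k⇒≤2^k∸2 : ∀ d c → 2 * c ≤ 2 ^ suc (suc d) → c ≤ simplexLength (suc (suc d)) ∸ 1
2*≤2^k⇒≤2^k∸2 d c 2c≤ =
  ≤-trans (*-cancelˡ-≤ 2 (≤-trans 2c≤ (≤-reflexive 2^k≡))) (+-monoˡ-≤ N (s≤s z≤n))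
  where
    open ≡-Reasoning
    N : ℕ
    N = simplexLength (suc d)
    2^k≡ : 2 ^ suc (suc d) ≡ 2 * suc N
    2^k≡ = begin
      2 ^ suc (suc d)    ≡⟨ suc-simplexLength (suc (suc d)) ⟨
      suc (suc (N + N))  ≡⟨ cong suc (+-suc N N) ⟨
      suc N + suc N      ≡⟨ cong (suc N +_) (+-identityʳ (suc N)) ⟨
      2 * suc N          ∎

lighten : ∀ {n} k → 2 ≤ k → (E : Matrix n) → Admissible (simplexLength k) E →
          Σ[ E′ ∈ Matrix n ] Admissible (simplexLength k ∸ 1) E′
                           × (∀ {K} → WeightBounded K E → WeightBounded K E′)
lighten zero          ()               E adm
lighten (suc zero)    (s≤s ())         E adm
lighten {n} (suc (suc d)) _ E adm = go E adm (<-wellFounded _)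
  where
    k m : ℕ
    k = suc (suc d)
    m = simplexLength k ∸ 1

    go : ∀ E → Admissible (suc m) E → Acc _<_ (count (heavy m E)) →
         Σ[ E′ ∈ Matrix n ] Admissible m E′ × (∀ {K} → WeightBounded K E → WeightBounded K E′)
    go E adm (acc smaller) with any? (λ j → m <? columnWeight E j)
    ... | no noneHeavy =
      E , record { diagonal = diagonal ; columns = λ j → ≮⇒≥ (λ h → noneHeavy (j , h)) } , id
      where open Admissible adm
    ... | yes (j₀ , heavy-j₀) =
      let E″ , adm″ , bounded″ = go E′ adm′ (smaller fewerHeavy) in E″ , adm″ , bounded″ ∘ E′-weightBounded
      where
        open Admissible adm
        open Exchange {k = k} E j₀ (≤-antisym (columns j₀) heavy-j₀)

        inside-light : ∀ j → T (S j) → columnWeight E′ j ≤ m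
        inside-light j Sj = 2*≤2^k⇒≤2^k∸2 d _ (columnWeight-inside j Sj)

        columns′ : ∀ j → columnWeight E′ j ≤ suc m
        columns′ j with T? (S j)
        ... | yes Sj = m≤n⇒m≤1+n (inside-light j Sj)
        ... | no ¬Sj = ≤-trans (columnWeight-outside j ¬Sj) (columns j)

        adm′ : Admissible (suc m) E′
        adm′ = record { diagonal = E′-diagonal diagonal ; columns = columns′ }

        stays-heavy : ∀ j → T (heavy m E′ j) → T (heavy m E j)
        stays-heavy j h with T? (S j)
        ... | yes Sj = ⊥-elim (<⇒≱ (<ᵇ⇒< m _ h) (inside-light j Sj))
        ... | no ¬Sj = <⇒<ᵇ (<-≤-trans (<ᵇ⇒< m _ h) (columnWeight-outside j ¬Sj))

        fewerHeavy : count (heavy m E′) < count (heavy m E)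
        fewerHeavy = count-mono-< j₀ stays-heavy
          (λ h → <⇒≱ (<ᵇ⇒< m _ h) (inside-light j₀ (diagonal j₀))) (<⇒<ᵇ heavy-j₀)

-- Matrices as vectors of rows

fromFunction : ∀ {n} → Matrix n → Mat n
fromFunction E = tabulate (λ i → tabulate (E i))

entry-fromFunction : ∀ {n} (E : Matrix n) i j → entry (fromFunction E) i j ≡ E i j
entry-fromFunction E i j =
  trans (cong (λ row → lookup row j) (lookup∘tabulate (λ i → tabulate (E i)) i)) (lookup∘tabulate (E i) j)

countOnes-tabulate : ∀ {n} (f : Fin n → Bool) → countOnes (tabulate f) ≡ count f
countOnes-tabulate {zero}  f = refl
countOnes-tabulate {suc n} f with f zero
... | true  = cong suc (countOnes-tabulate (f ∘ suc))
... | false = countOnes-tabulate (f ∘ suc)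

sumF₂-tabulate : ∀ {n} (f : Fin n → Bool) → sumF₂ (tabulate f) ≡ ⊕.sum f
sumF₂-tabulate {zero}  f = refl
sumF₂-tabulate {suc n} f = cong (f zero xor_) (sumF₂-tabulate (f ∘ suc))

weight-· : ∀ {n} (W : Mat n) x → weight (W · x) ≡ count (apply (entry W) (lookup x))
weight-· {n} W x = trans (countOnes-tabulate (λ i → sumF₂ (tabulate (row i))))
                     (count-cong (λ i → sumF₂-tabulate (row i)))
  where row : Fin n → Fin n → Bool
        row i j = entry W i j ∧ lookup x j

allB-tabulate⁻ : ∀ {n} (f : Fin n → Bool) → T (allB (tabulate f)) → ∀ i → T (f i)
allB-tabulate⁻ f h zero    = proj₁ (Equivalence.to (T-∧ {f zero}) h)
allB-tabulate⁻ f h (suc i) = allB-tabulate⁻ (f ∘ suc) (proj₂ (Equivalence.to (T-∧ {f zero}) h)) i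

allB-tabulate⁺ : ∀ {n} (f : Fin n → Bool) → (∀ i → T (f i)) → T (allB (tabulate f))
allB-tabulate⁺ {zero}  f h = tt
allB-tabulate⁺ {suc n} f h = Equivalence.from (T-∧ {f zero}) (h zero , allB-tabulate⁺ (f ∘ suc) (h ∘ suc))

inA⇒admissible : ∀ {n m} (W : Mat n) → T (inA n m W) → Admissible m (entry W)
inA⇒admissible {m = m} W h = record
  { diagonal = allB-tabulate⁻ _ (proj₁ diag×cols)
  ; columns  = λ j → subst (_≤ m) (countOnes-tabulate (λ i → entry W i j))
                            (≤ᵇ⇒≤ _ m (allB-tabulate⁻ _ (proj₂ diag×cols) j))
  }
  where diag×cols : T (diagOnes W) × T (colsAtMost m W)
        diag×cols = Equivalence.to (T-∧ {diagOnes W}) h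

admissible⇒inA : ∀ {n m} (W : Mat n) → Admissible m (entry W) → T (inA n m W)
admissible⇒inA {m = m} W adm = Equivalence.from (T-∧ {diagOnes W})
  ( allB-tabulate⁺ _ diagonal
  , allB-tabulate⁺ _ (λ j → ≤⇒≤ᵇ (subst (_≤ m) (sym (countOnes-tabulate (λ i → entry W i j))) (columns j))))
  where open Admissible adm

∈-allVecsOf : ∀ {X : Set} {xs : List X} → (∀ a → a ∈ xs) → ∀ {n} (v : Vec X n) → v ∈ allVecsOf xs n
∈-allVecsOf complete []      = here refl
∈-allVecsOf complete (a ∷ v) =
  ∈-concatMap⁺ _ (Any.map (λ { refl → ∈-map⁺ (a ∷_) (∈-allVecsOf complete v) }) (complete a))

∈-allVecs : ∀ {n} (v : Vec Bool n) → v ∈ allVecs n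
∈-allVecs = ∈-allVecsOf λ { false → here refl ; true → there (here refl) }

∈-allMats : ∀ {n} (W : Mat n) → W ∈ allMats n
∈-allMats = ∈-allVecsOf ∈-allVecs

∈A⇒admissible : ∀ {n m} {W : Mat n} → W ∈ A n m → Admissible m (entry W)
∈A⇒admissible {n} {m} {W} W∈ =
  inA⇒admissible W (Equivalence.from T-≡ (proj₂ (∈-filter⁻ (λ W → inA n m W Bool.≟ true) {xs = allMats n} W∈)))

admissible⇒∈A : ∀ {n m} {W : Mat n} → Admissible m (entry W) → W ∈ A n m
admissible⇒∈A {n} {m} {W} adm =
  ∈-filter⁺ (λ W → inA n m W Bool.≟ true) (∈-allMats W) (Equivalence.to T-≡ (admissible⇒inA W adm))

≤-maxList : ∀ {xs : List ℕ} {x} → x ∈ xs → x ≤ maxList xs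
≤-maxList (here refl)          = m≤m⊔n _ _
≤-maxList {y ∷ xs} (there x∈) = ≤-trans (≤-maxList x∈) (m≤n⊔m y _)

maxList-map-≤ : ∀ {X : Set} (f : X → ℕ) xs {K} → (∀ x → f x ≤ K) → maxList (map f xs) ≤ K
maxList-map-≤ f []       f≤ = z≤n
maxList-map-≤ f (x ∷ xs) f≤ = ⊔-lub (f≤ x) (maxList-map-≤ f xs f≤)

M-weightBounded : ∀ {n} (W : Mat n) → WeightBounded (M W) (entry W)
M-weightBounded W x = subst (_≤ M W) weight≡ (≤-maxList (∈-map⁺ _ (∈-allVecs (tabulate x))))
  where
    weight≡ : weight (W · tabulate x) ≡ count (apply (entry W) x)
    weight≡ = trans (weight-· W (tabulate x)) (count-cong (apply-cong (λ _ _ → refl) (lookup∘tabulate x)))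

M-least : ∀ {n K} (W : Mat n) → WeightBounded K (entry W) → M W ≤ K
M-least {K = K} W bounded =
  maxList-map-≤ _ (allVecs _) (λ v → subst (_≤ K) (sym (weight-· W v)) (bounded (lookup v)))

minList≡nothing⇒∉ : ∀ xs {x} → minList xs ≡ nothing → ¬ x ∈ xs
minList≡nothing⇒∉ (y ∷ ys) eq _ with minList ys
minList≡nothing⇒∉ (y ∷ ys) () _ | nothing
minList≡nothing⇒∉ (y ∷ ys) () _ | just _

minList≡just⇒minimum : ∀ xs {v} → minList xs ≡ just v → v ∈ xs × (∀ {x} → x ∈ xs → v ≤ x)
minList≡just⇒minimum (y ∷ ys) eq with minList ys in eq′
minList≡just⇒minimum (y ∷ ys) refl | nothing =
  here refl , λ { (here refl) → ≤-refl ; (there x∈) → ⊥-elim (minList≡nothing⇒∉ ys eq′ x∈) }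
minList≡just⇒minimum (y ∷ ys) refl | just u with minList≡just⇒minimum ys eq′
... | u∈ , u≤ = y⊓u∈ , y⊓u≤
  where
    y⊓u∈ : y ⊓ u ∈ y ∷ ys
    y⊓u∈ with ⊓-sel y u
    ... | inj₁ y⊓u≡y rewrite y⊓u≡y = here refl
    ... | inj₂ y⊓u≡u rewrite y⊓u≡u = there u∈
    y⊓u≤ : ∀ {x} → x ∈ y ∷ ys → y ⊓ u ≤ x
    y⊓u≤ (here refl) = m⊓n≤m y u
    y⊓u≤ (there x∈)  = ≤-trans (m⊓n≤n y u) (u≤ x∈)

BoundedBelowBy : List ℕ → List ℕ → Set
BoundedBelowBy xs ys = ∀ {x} → x ∈ xs → ∃[ y ] y ∈ ys × y ≤ x

minList-cong : ∀ xs ys → BoundedBelowBy xs ys → BoundedBelowBy ys xs → minList xs ≡ minList ys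
minList-cong xs ys xs≥ys ys≥xs with minList xs in eq₁ | minList ys in eq₂
... | nothing | nothing = refl
... | just v  | nothing =
  ⊥-elim (minList≡nothing⇒∉ ys eq₂ (proj₁ (proj₂ (xs≥ys (proj₁ (minList≡just⇒minimum xs eq₁))))))
... | nothing | just u  =
  ⊥-elim (minList≡nothing⇒∉ xs eq₁ (proj₁ (proj₂ (ys≥xs (proj₁ (minList≡just⇒minimum ys eq₂))))))
... | just v  | just u  with minList≡just⇒minimum xs eq₁ | minList≡just⇒minimum ys eq₂
... | v∈ , v≤ | u∈ , u≤ with xs≥ys v∈ | ys≥xs u∈
... | y , y∈ , y≤v | x , x∈ , x≤u = cong just (≤-antisym (≤-trans (v≤ x∈) x≤u) (≤-trans (u≤ y∈) y≤v))

DominatedBy : ℕ → ℕ → ℕ → Set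
DominatedBy n m m′ = ∀ {W} → W ∈ A n m → ∃[ W′ ] W′ ∈ A n m′ × M W′ ≤ M W

μ-cong : ∀ {n m m′} → DominatedBy n m m′ → DominatedBy n m′ m → μ n m ≡ μ n m′
μ-cong {n} dominated dominated′ = minList-cong _ _ (boundedBelow dominated) (boundedBelow dominated′)
  where
    boundedBelow : ∀ {a b} → DominatedBy n a b → BoundedBelowBy (map M (A n a)) (map M (A n b))
    boundedBelow dom x∈ with ∈-map⁻ M x∈
    ... | W , W∈ , refl with dom W∈
    ... | W′ , W′∈ , M≤ = M W′ , ∈-map⁺ M W′∈ , M≤

A-mono : ∀ {n m m′} → m ≤ m′ → DominatedBy n m m′
A-mono {m′ = m′} m≤m′ {W} W∈ = W , admissible⇒∈A weakened , ≤-refl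
  where
    open Admissible (∈A⇒admissible W∈)
    weakened : Admissible m′ (entry W)
    weakened = record { diagonal = diagonal ; columns = λ j → ≤-trans (columns j) m≤m′ }

A-lighten : ∀ {n} k → 2 ≤ k → DominatedBy n (simplexLength k) (simplexLength k ∸ 1)
A-lighten k 2≤k {W} W∈ with lighten k 2≤k (entry W) (∈A⇒admissible W∈)
... | E′ , adm , preserves =
  fromFunction E′ ,
  admissible⇒∈A (admissible-resp entries adm) ,
  M-least (fromFunction E′) (weightBounded-resp entries (preserves (M-weightBounded W)))
  where
    entries : ∀ i j → E′ i j ≡ entry (fromFunction E′) i j
    entries i j = sym (entry-fromFunction E′ i j)

proposition5p1 : (k n : ℕ) → 2 ≤ k → μ n (2 ^ k ∸ 1) ≡ μ n (2 ^ k ∸ 2)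
-- Rewriting 2^k as suc (simplexLength k) turns the two thresholds into simplexLength k and its predecessor.
proposition5p1 k n 2≤k rewrite sym (suc-simplexLength k) =
  μ-cong {n} (A-lighten k 2≤k) (A-mono (m∸n≤m (simplexLength k) 1))
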